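{- Let $C\in\mathbb{B}^{\ell\times m}$, $D\in\mathbb{B}^{\ell\times n}$, and let $G=(U,V,E_1,\dots,E_\ell)$ be an $\ell$-type $(C,D)$-biregular graph with witnessing partitions $U=U_1\cup\dots\cup U_m$ and $V=V_1\cup\dots\cup V_n$. Suppose that $|U_i|\ge\lfloor C\rfloor\cdot\bar1+\lfloor D\rfloor\cdot\bar1+1$ and $|V_j|\ge\lfloor C\rfloor\cdot\bar1+\lfloor D\rfloor\cdot\bar1+1$ for all $i,j$. If $G$ is a complete bipartite graph (i.e. $U\times V=E_1\cup\dots\cup E_\ell$), then for every $i\in\{1,\dots,m\}$ and $j\in\{1,\dots,n\}$ there exists $l\in\{1,\dots,\ell\}$ such that both $C_{l,i}$ and $D_{l,j}$ are of the form ${\ge}k$ for some $k\in\mathbb{N}$.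
   Context: $\mathbb{B}=\mathbb{N}\cup\{{\ge}d\mid d\in\mathbb{N}\}$, "$x={\ge}d$" meaning $x\ge d$; $\lfloor{\ge}d\rfloor=d$, $\lfloor d\rfloor=d$, applied entrywise; $\lfloor C\rfloor\cdot\bar1$ denotes the sum of all entries of $\lfloor C\rfloor$. An $\ell$-type bipartite graph is $G=(U,V,E_1,\dots,E_\ell)$ with pairwise disjoint $E_i\subseteq U\times V$; $\deg_{E_i}(u)$ is the number of $E_i$-edges at $u$. $G$ is $(C,D)$-biregular with witnessing partitions $U=U_1\cup\dots\cup U_m$, $V=V_1\cup\dots\cup V_n$ if $\deg_{E_i}(u)=C_{i,j}$ for all $u\in U_j$ and $\deg_{E_i}(v)=D_{i,j}$ for all $v\in V_j$, for all $i$. -}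

module Defs where

open import Data.Nat using (ℕ; zero; suc; _+_; _≥_)
open import Data.Bool using (Bool; true; false; if_then_else_)
open import Data.Fin using (Fin)
open import Data.Fin.Properties using (_≟_)
open import Data.List using (List; map; allFin)
open import Data.Nat.ListAction using (sum)
open import Data.Product using (Σ; _×_)
open import Relation.Binary.PropositionalEquality using (_≡_)
open import Relation.Nullary using (does)

-- The set 𝔹 = ℕ ∪ {≥d | d ∈ ℕ}
data 𝔹 : Set where
  exactly : ℕ → 𝔹
  atLeast : ℕ → 𝔹

-- "x = b" in the sense of the paper
_satisfies_ : ℕ → 𝔹 → Set
x satisfies exactly d = x ≡ d
x satisfies atLeast d = x ≥ d

⌊_⌋ : 𝔹 → ℕ
⌊ exactly d ⌋ = d
⌊ atLeast d ⌋ = d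

IsAtLeast : 𝔹 → Set
IsAtLeast b = Σ ℕ λ k → b ≡ atLeast k

Σ[_]_ : (n : ℕ) → (Fin n → ℕ) → ℕ
Σ[ n ] f = sum (map f (allFin n))

-- ⌊C⌋·1̄ : sum of all entries of ⌊C⌋, C an ℓ×m matrix over 𝔹
floorSum : {ℓ m : ℕ} → (Fin ℓ → Fin m → 𝔹) → ℕ
floorSum {ℓ} {m} C = Σ[ ℓ ] (λ i → Σ[ m ] (λ j → ⌊ C i j ⌋))

count : (n : ℕ) → (Fin n → Bool) → ℕ
count n P = Σ[ n ] (λ x → if P x then 1 else 0)

-- ℓ-type bipartite graph with U = Fin p, V = Fin q; E i u v = true iff (u,v) ∈ E_i
record TypedBipartite (ℓ p q : ℕ) : Set where
  field
    E        : Fin ℓ → Fin p → Fin q → Bool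
    disjoint : ∀ i i' u v → E i u v ≡ true → E i' u v ≡ true → i ≡ i'

open TypedBipartite public

degU : ∀ {ℓ p q} → TypedBipartite ℓ p q → Fin ℓ → Fin p → ℕ
degU {q = q} G i u = count q (λ v → E G i u v)

degV : ∀ {ℓ p q} → TypedBipartite ℓ p q → Fin ℓ → Fin q → ℕ
degV {p = p} G i v = count p (λ u → E G i u v)

-- size of the j-th block of a partition given as a block-assignment map
blockSize : ∀ {p m} → (Fin p → Fin m) → Fin m → ℕ
blockSize {p} π j = count p (λ u → does (π u ≟ j))

-- G is (C,D)-biregular with witnessing partitions πU (U_j = πU⁻¹ j), πV
IsBiregular : ∀ {ℓ p q m n} → TypedBipartite ℓ p q →
              (Fin ℓ → Fin m → 𝔹) → (Fin ℓ → Fin n → 𝔹) →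
              (Fin p → Fin m) → (Fin q → Fin n) → Set
IsBiregular G C D πU πV =
  (∀ i u → degU G i u satisfies C i (πU u)) ×
  (∀ i v → degV G i v satisfies D i (πV v))

IsComplete : ∀ {ℓ p q} → TypedBipartite ℓ p q → Set
IsComplete {ℓ} G = ∀ u v → Σ (Fin ℓ) λ i → E G i u v ≡ true

-- Fix blocks U_i, V_j and count the pairs in U_i × V_j.  By completeness there are at least
-- |U_i|·|V_j| of them, each carrying an edge of some type l.  If no type is of the form ≥ on
-- both sides, then for every l one of C_{l,i}, D_{l,j} is exact, so the E_l-edges between the
-- blocks number at most |U_i|·⌊C_{l,i}⌋ or at most |V_j|·⌊D_{l,j}⌋.  Summing over l gives
-- a·b ≤ a·c + b·d for a = |U_i|, b = |V_j|, c ≤ ⌊C⌋·1̄, d ≤ ⌊D⌋·1̄; but a, b > c + d forces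
-- a·c + b·d ≤ max(a,b)·(c + d) < a·b.
module Submission where

open import Defs
open import Data.Bool using (Bool; true; false; if_then_else_)
open import Data.Empty using (⊥-elim)
open import Data.Fin using (Fin; zero; suc)
open import Data.Fin.Properties using (_≟_; any?)
open import Data.List using (tabulate)
open import Data.List.Properties using (map-tabulate)
open import Data.Nat using (ℕ; zero; suc; _+_; _*_; _≤_; _<_; _≥_; z≤n)
open import Data.Nat.ListAction as List using ()
open import Data.Nat.Properties hiding (_≟_)
open import Algebra.Properties.Semiring.Sum +-*-semiring
  using (sum; sum-cong-≗; ∑-comm; ∑-distrib-+; *-distribˡ-sum; *-distribʳ-sum)
open import Data.Product using (Σ; _×_; _,_; proj₁; proj₂)
open import Data.Sum using (inj₁; inj₂)
open import Function using (_∘_; id; flip)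
open import Relation.Binary.PropositionalEquality
open import Relation.Nullary using (Dec; yes; no; ¬_; does)
open import Relation.Nullary.Decidable using (_×-dec_)

open ≤-Reasoning

sum-tabulate : ∀ {n} (f : Fin n → ℕ) → List.sum (tabulate f) ≡ sum f
sum-tabulate {zero}  f = refl
sum-tabulate {suc n} f = cong (f zero +_) (sum-tabulate (f ∘ suc))

Σ≡∑ : ∀ n (f : Fin n → ℕ) → Σ[ n ] f ≡ sum f
Σ≡∑ n f = trans (cong List.sum (map-tabulate id f)) (sum-tabulate f)

sum-mono-≤ : ∀ {n} {f g : Fin n → ℕ} → (∀ x → f x ≤ g x) → sum f ≤ sum g
sum-mono-≤ {zero}  f≤g = z≤n
sum-mono-≤ {suc n} f≤g = +-mono-≤ (f≤g zero) (sum-mono-≤ (f≤g ∘ suc))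

≤-sum : ∀ {n} (f : Fin n → ℕ) x → f x ≤ sum f
≤-sum f zero    = m≤m+n (f zero) _
≤-sum f (suc x) = ≤-trans (≤-sum (f ∘ suc) x) (m≤n+m _ (f zero))

sum-linear : ∀ {n} a b (f g : Fin n → ℕ) → (sum λ x → a * f x + b * g x) ≡ a * sum f + b * sum g
sum-linear a b f g = trans (∑-distrib-+ (λ x → a * f x) (λ x → b * g x))
                           (sym (cong₂ _+_ (*-distribˡ-sum a f) (*-distribˡ-sum b g)))

𝟙 : Bool → ℕ
𝟙 b = if b then 1 else 0

𝟙≤1 : ∀ b → 𝟙 b ≤ 1
𝟙≤1 true  = ≤-refl
𝟙≤1 false = z≤n

bilinear : ∀ {p q} → (Fin p → ℕ) → (Fin p → Fin q → ℕ) → (Fin q → ℕ) → ℕ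
bilinear x r y = sum λ u → sum λ v → x u * r u v * y v

bilinear-transpose : ∀ {p q} x (r : Fin p → Fin q → ℕ) y →
                     bilinear x r y ≡ bilinear y (flip r) x
bilinear-transpose x r y = begin-equality
  (sum λ u → sum λ v → x u * r u v * y v)
    ≡⟨ ∑-comm (λ u v → x u * r u v * y v) ⟩
  (sum λ v → sum λ u → x u * r u v * y v)
    ≡⟨ sum-cong-≗ (λ v → sum-cong-≗ (λ u → reverse (x u) (r u v) (y v))) ⟩
  (sum λ v → sum λ u → y v * r u v * x u)
    ∎
  where
  reverse : ∀ a b c → a * b * c ≡ c * b * a
  reverse a b c = begin-equality
    a * b * c    ≡⟨ *-comm (a * b) c ⟩
    c * (a * b)  ≡⟨ cong (c *_) (*-comm a b) ⟩
    c * (b * a)  ≡⟨ *-assoc c b a ⟨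
    c * b * a    ∎

bilinear-mono-≤ : ∀ {p q} x {r r′ : Fin p → Fin q → ℕ} y → (∀ u v → r u v ≤ r′ u v) →
                  bilinear x r y ≤ bilinear x r′ y
bilinear-mono-≤ x y r≤r′ =
  sum-mono-≤ λ u → sum-mono-≤ λ v → *-monoˡ-≤ (y v) (*-monoʳ-≤ (x u) (r≤r′ u v))

bilinear-const-1 : ∀ {p q} x (y : Fin q → ℕ) → bilinear {p} x (λ _ _ → 1) y ≡ sum x * sum y
bilinear-const-1 x y = begin-equality
  (sum λ u → sum λ v → x u * 1 * y v)
    ≡⟨ sum-cong-≗ (λ u → sum-cong-≗ (λ v → cong (_* y v) (*-identityʳ (x u)))) ⟩
  (sum λ u → sum λ v → x u * y v)      ≡⟨ sum-cong-≗ (λ u → *-distribˡ-sum (x u) y) ⟨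
  (sum λ u → x u * sum y)              ≡⟨ *-distribʳ-sum (sum y) x ⟨
  sum x * sum y                        ∎

bilinear-sum : ∀ {ℓ p q} x (r : Fin ℓ → Fin p → Fin q → ℕ) y →
               (sum λ l → bilinear x (r l) y) ≡ bilinear x (λ u v → sum λ l → r l u v) y
bilinear-sum x r y = begin-equality
  (sum λ l → sum λ u → sum λ v → x u * r l u v * y v)
    ≡⟨ ∑-comm (λ l u → sum λ v → x u * r l u v * y v) ⟩
  (sum λ u → sum λ l → sum λ v → x u * r l u v * y v)
    ≡⟨ sum-cong-≗ (λ u → ∑-comm (λ l v → x u * r l u v * y v)) ⟩
  (sum λ u → sum λ v → sum λ l → x u * r l u v * y v)
    ≡⟨ sum-cong-≗ (λ u → sum-cong-≗ (λ v → factor u v)) ⟩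
  (sum λ u → sum λ v → x u * (sum λ l → r l u v) * y v)
    ∎
  where
  factor : ∀ u v → (sum λ l → x u * r l u v * y v) ≡ x u * (sum λ l → r l u v) * y v
  factor u v = begin-equality
    (sum λ l → x u * r l u v * y v)    ≡⟨ *-distribʳ-sum (y v) (λ l → x u * r l u v) ⟨
    (sum λ l → x u * r l u v) * y v    ≡⟨ cong (_* y v) (*-distribˡ-sum (x u) (λ l → r l u v)) ⟨
    x u * (sum λ l → r l u v) * y v    ∎

bilinear-≤-rows : ∀ {p q} x (r : Fin p → Fin q → ℕ) y → (∀ v → y v ≤ 1) →
                  bilinear x r y ≤ sum λ u → x u * sum (r u)
bilinear-≤-rows x r y y≤1 =
  ≤-trans (sum-mono-≤ λ u → sum-mono-≤ λ v → drop-y u v)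
          (≤-reflexive (sum-cong-≗ λ u → sym (*-distribˡ-sum (x u) (r u))))
  where
  drop-y : ∀ u v → x u * r u v * y v ≤ x u * r u v
  drop-y u v = ≤-trans (*-monoʳ-≤ (x u * r u v) (y≤1 v)) (≤-reflexive (*-identityʳ _))

inBlock : ∀ {p m} → (Fin p → Fin m) → Fin m → Fin p → ℕ
inBlock π i u = 𝟙 (does (π u ≟ i))

blockSize≡∑ : ∀ {p m} (π : Fin p → Fin m) i → blockSize π i ≡ sum (inBlock π i)
blockSize≡∑ {p} π i = Σ≡∑ p (inBlock π i)

∑-inBlock-* : ∀ {p m} (π : Fin p → Fin m) i (g : Fin p → ℕ) {k} →
              (∀ u → π u ≡ i → g u ≡ k) → (sum λ u → inBlock π i u * g u) ≡ blockSize π i * k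
∑-inBlock-* π i g {k} g≡k = begin-equality
  (sum λ u → inBlock π i u * g u)  ≡⟨ sum-cong-≗ on-block ⟩
  (sum λ u → inBlock π i u * k)    ≡⟨ *-distribʳ-sum k (inBlock π i) ⟨
  sum (inBlock π i) * k            ≡⟨ cong (_* k) (blockSize≡∑ π i) ⟨
  blockSize π i * k                ∎
  where
  on-block : ∀ u → inBlock π i u * g u ≡ inBlock π i u * k
  on-block u with π u ≟ i
  ... | yes πu≡i = cong (1 *_) (g≡k u πu≡i)
  ... | no  _    = refl

bilinear-≤-block : ∀ {p q m} (π : Fin p → Fin m) i (r : Fin p → Fin q → ℕ) y {k} →
                   (∀ v → y v ≤ 1) → (∀ u → π u ≡ i → sum (r u) ≡ k) →
                   bilinear (inBlock π i) r y ≤ blockSize π i * k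
bilinear-≤-block π i r y y≤1 regular =
  ≤-trans (bilinear-≤-rows (inBlock π i) r y y≤1)
          (≤-reflexive (∑-inBlock-* π i (sum ∘ r) regular))

IsAtLeast? : ∀ b → Dec (IsAtLeast b)
IsAtLeast? (exactly k) = no λ ()
IsAtLeast? (atLeast k) = yes (k , refl)

satisfies⇒≡⌊⌋ : ∀ {x b} → x satisfies b → ¬ IsAtLeast b → x ≡ ⌊ b ⌋
satisfies⇒≡⌊⌋ {b = exactly k} x≡k _ = x≡k
satisfies⇒≡⌊⌋ {b = atLeast k} _ ¬≥ = ⊥-elim (¬≥ (k , refl))

ac+bd<ab-≤ : ∀ {a b c d} → a ≤ b → c + d + 1 ≤ a → a * c + b * d < a * b
ac+bd<ab-≤ {a} {b} {c} {d} a≤b c+d<a = begin-strict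
  a * c + b * d        ≤⟨ +-monoˡ-≤ (b * d) (*-monoˡ-≤ c a≤b) ⟩
  b * c + b * d        ≡⟨ *-distribˡ-+ b c d ⟨
  b * (c + d)          <⟨ m<m+n (b * (c + d)) 0<b*1 ⟩
  b * (c + d) + b * 1  ≡⟨ *-distribˡ-+ b (c + d) 1 ⟨
  b * (c + d + 1)      ≤⟨ *-monoʳ-≤ b c+d<a ⟩
  b * a                ≡⟨ *-comm b a ⟩
  a * b                ∎
  where
  0<b*1 : 0 < b * 1
  0<b*1 = ≤-trans (≤-trans (m≤n+m 1 (c + d)) (≤-trans c+d<a a≤b))
                  (≤-reflexive (sym (*-identityʳ b)))

ac+bd<ab : ∀ {a b c d} → c + d + 1 ≤ a → c + d + 1 ≤ b → a * c + b * d < a * b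
ac+bd<ab {a} {b} {c} {d} c+d<a c+d<b with ≤-total a b
... | inj₁ a≤b = ac+bd<ab-≤ a≤b c+d<a
... | inj₂ b≤a = subst₂ _<_ (+-comm (b * d) (a * c)) (*-comm b a)
                   (ac+bd<ab-≤ b≤a (subst (λ s → s + 1 ≤ b) (+-comm c d) c+d<b))

floorSum≡∑∑ : ∀ {ℓ m} (C : Fin ℓ → Fin m → 𝔹) → floorSum C ≡ sum λ l → sum λ k → ⌊ C l k ⌋
floorSum≡∑∑ {ℓ} {m} C = trans (Σ≡∑ ℓ _) (sum-cong-≗ λ l → Σ≡∑ m (λ k → ⌊ C l k ⌋))

∑column≤floorSum : ∀ {ℓ m} (C : Fin ℓ → Fin m → 𝔹) i → (sum λ l → ⌊ C l i ⌋) ≤ floorSum C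
∑column≤floorSum C i = begin
  (sum λ l → ⌊ C l i ⌋)              ≤⟨ sum-mono-≤ (λ l → ≤-sum (λ k → ⌊ C l k ⌋) i) ⟩
  (sum λ l → sum λ k → ⌊ C l k ⌋)    ≡⟨ floorSum≡∑∑ C ⟨
  floorSum C                         ∎

adjacency : ∀ {ℓ p q} → TypedBipartite ℓ p q → Fin ℓ → Fin p → Fin q → ℕ
adjacency G l u v = 𝟙 (E G l u v)

module _ {ℓ p q m n} (G : TypedBipartite ℓ p q) (πU : Fin p → Fin m) (πV : Fin q → Fin n)
         (i : Fin m) (j : Fin n) where

  crossEdges : Fin ℓ → ℕ
  crossEdges l = bilinear (inBlock πU i) (adjacency G l) (inBlock πV j)

  1≤∑adjacency : IsComplete G → ∀ u v → 1 ≤ sum λ l → adjacency G l u v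
  1≤∑adjacency complete u v with complete u v
  ... | l , uv∈E = ≤-trans (≤-reflexive (cong 𝟙 (sym uv∈E))) (≤-sum (λ k → adjacency G k u v) l)

  blockSize*blockSize≤∑crossEdges : IsComplete G →
                                    blockSize πU i * blockSize πV j ≤ sum crossEdges
  blockSize*blockSize≤∑crossEdges complete = begin
    blockSize πU i * blockSize πV j
      ≡⟨ cong₂ _*_ (blockSize≡∑ πU i) (blockSize≡∑ πV j) ⟩
    sum x * sum y
      ≡⟨ bilinear-const-1 x y ⟨
    bilinear x (λ _ _ → 1) y
      ≤⟨ bilinear-mono-≤ x y (1≤∑adjacency complete) ⟩
    bilinear x (λ u v → sum λ l → adjacency G l u v) y
      ≡⟨ bilinear-sum x (adjacency G) y ⟨
    sum crossEdges
      ∎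
    where
    x : Fin p → ℕ
    x = inBlock πU i
    y : Fin q → ℕ
    y = inBlock πV j

  module _ {C : Fin ℓ → Fin m → 𝔹} {D : Fin ℓ → Fin n → 𝔹}
           (biregular : IsBiregular G C D πU πV) (l : Fin ℓ) where

    crossEdges-≤ᵁ : ¬ IsAtLeast (C l i) → crossEdges l ≤ blockSize πU i * ⌊ C l i ⌋
    crossEdges-≤ᵁ exact =
      bilinear-≤-block πU i (adjacency G l) (inBlock πV j) (λ v → 𝟙≤1 _) regular
      where
      regular : ∀ u → πU u ≡ i → sum (adjacency G l u) ≡ ⌊ C l i ⌋
      regular u πu≡i = trans (sym (Σ≡∑ q _))
        (satisfies⇒≡⌊⌋ (subst (λ k → degU G l u satisfies C l k) πu≡i (proj₁ biregular l u)) exact)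

    crossEdges-≤ⱽ : ¬ IsAtLeast (D l j) → crossEdges l ≤ blockSize πV j * ⌊ D l j ⌋
    crossEdges-≤ⱽ exact = begin
      crossEdges l
        ≡⟨ bilinear-transpose (inBlock πU i) (adjacency G l) (inBlock πV j) ⟩
      bilinear (inBlock πV j) (flip (adjacency G l)) (inBlock πU i)
        ≤⟨ bilinear-≤-block πV j (flip (adjacency G l)) (inBlock πU i) (λ u → 𝟙≤1 _) regular ⟩
      blockSize πV j * ⌊ D l j ⌋
        ∎
      where
      regular : ∀ v → πV v ≡ j → (sum λ u → adjacency G l u v) ≡ ⌊ D l j ⌋
      regular v πv≡j = trans (sym (Σ≡∑ p _))
        (satisfies⇒≡⌊⌋ (subst (λ k → degV G l v satisfies D l k) πv≡j (proj₂ biregular l v)) exact)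

    crossEdges-≤ : ¬ (IsAtLeast (C l i) × IsAtLeast (D l j)) →
                   crossEdges l ≤ blockSize πU i * ⌊ C l i ⌋ + blockSize πV j * ⌊ D l j ⌋
    crossEdges-≤ not-both with IsAtLeast? (C l i)
    ... | no  C-exact = ≤-trans (crossEdges-≤ᵁ C-exact) (m≤m+n _ _)
    ... | yes C-atLeast =
      ≤-trans (crossEdges-≤ⱽ (λ D-atLeast → not-both (C-atLeast , D-atLeast))) (m≤n+m _ _)

lemma4 : (ℓ m n p q : ℕ)
         (C : Fin ℓ → Fin m → 𝔹) (D : Fin ℓ → Fin n → 𝔹)
         (G : TypedBipartite ℓ p q)
         (πU : Fin p → Fin m) (πV : Fin q → Fin n) →
         IsBiregular G C D πU πV →
         (∀ i → blockSize πU i ≥ floorSum C + floorSum D + 1) →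
         (∀ j → blockSize πV j ≥ floorSum C + floorSum D + 1) →
         IsComplete G →
         ∀ i j → Σ (Fin ℓ) λ l → IsAtLeast (C l i) × IsAtLeast (D l j)
lemma4 ℓ m n p q C D G πU πV biregular U-large V-large complete i j
  with any? (λ l → IsAtLeast? (C l i) ×-dec IsAtLeast? (D l j))
... | yes found = found
... | no  none  =
  ⊥-elim (<⇒≱ (ac+bd<ab (≤-trans c+d≤ (U-large i)) (≤-trans c+d≤ (V-large j))) counted)
  where
  a b c d : ℕ
  a = blockSize πU i
  b = blockSize πV j
  c = sum λ l → ⌊ C l i ⌋
  d = sum λ l → ⌊ D l j ⌋

  c+d≤ : c + d + 1 ≤ floorSum C + floorSum D + 1
  c+d≤ = +-monoˡ-≤ 1 (+-mono-≤ (∑column≤floorSum C i) (∑column≤floorSum D j))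

  counted : a * b ≤ a * c + b * d
  counted = begin
    a * b
      ≤⟨ blockSize*blockSize≤∑crossEdges G πU πV i j complete ⟩
    sum (crossEdges G πU πV i j)
      ≤⟨ sum-mono-≤ (λ l → crossEdges-≤ G πU πV i j biregular l (λ both → none (l , both))) ⟩
    (sum λ l → a * ⌊ C l i ⌋ + b * ⌊ D l j ⌋)
      ≡⟨ sum-linear a b (λ l → ⌊ C l i ⌋) (λ l → ⌊ D l j ⌋) ⟩
    a * c + b * d
      ∎
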